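{- Let $m,n\ge2$ be integers and $\sigma,\vartheta\in\mathbb{R}$. Let $A(m,n,\sigma)$ be the matrix with $n-1$ rows and $m+n-2$ columns whose $(i,j)$ entry is $\sigma+j-i$ if $i\le j\le i+m-1$ and $0$ otherwise; the positions $(i,j)$ with $i\le j\le i+m-1$ are called marked. Let $X(m,n)$ be the $(m+n-2)\times(m+n-2)$ matrix obtained by placing $A(m,n,\sigma)$ on top of $A(n,m,\vartheta)$ (which has $m-1$ rows, with marked positions $i\le j\le i+n-1$ in its own row indexing). If one selects $m+n-2$ marked entries of $X(m,n)$ such that each row and each column contains exactly one selected entry, then the sum of the selected entries equals $$\Sigma(m,n,\sigma,\vartheta)=(m-1+\sigma)(n-1+\vartheta)-\sigma\vartheta.$$ -}

module Defs where

open import Level using (Level)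
open import Data.Nat using (ℕ; zero; suc; _∸_; _<ᵇ_) renaming (_+_ to _+ℕ_; _≤_ to _≤ℕ_)
open import Data.Fin using (Fin; toℕ)
open import Data.Fin.Permutation using (Permutation′; _⟨$⟩ʳ_)
open import Data.Bool using (if_then_else_)
open import Data.Product using (_×_)
open import Algebra.Bundles using (CommutativeRing)

module _ {c ℓ : Level} (R : CommutativeRing c ℓ) where
  open CommutativeRing R

  ι : ℕ → Carrier
  ι zero    = 0#
  ι (suc k) = 1# + ι k

  sumFin : (N : ℕ) → (Fin N → Carrier) → Carrier
  sumFin zero    f = 0#
  sumFin (suc N) f = f Fin.zero + sumFin N (λ i → f (Fin.suc i))

  -- Indices are 0-based here (the paper's are 1-based; the shift changes
  -- neither the marked condition nor the difference j - i).
  markedA : ℕ → ℕ → ℕ → Set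
  markedA m i j = (i ≤ℕ j) × (j ≤ℕ i +ℕ (m ∸ 1))

  entryA : Carrier → ℕ → ℕ → Carrier
  entryA σ i j = σ + ι (j ∸ i)

  markedX : ℕ → ℕ → ℕ → ℕ → Set
  markedX m n i j =
    if i <ᵇ (n ∸ 1) then markedA m i j else markedA n (i ∸ (n ∸ 1)) j

  entryX : ℕ → ℕ → Carrier → Carrier → ℕ → ℕ → Carrier
  entryX m n σ ϑ i j =
    if i <ᵇ (n ∸ 1) then entryA σ i j else entryA ϑ (i ∸ (n ∸ 1)) j

  bigΣ : ℕ → ℕ → Carrier → Carrier → Carrier
  bigΣ m n σ ϑ = ((ι (m ∸ 1) + σ) * (ι (n ∸ 1) + ϑ)) - (σ * ϑ)

  -- A selection of m+n-2 marked entries, exactly one per row and column,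
  -- is a permutation π of Fin (m+n-2) with every (i, π i) marked.
  selectionSum : (m n : ℕ) → Carrier → Carrier → Permutation′ ((m +ℕ n) ∸ 2) → Carrier
  selectionSum m n σ ϑ π =
    sumFin ((m +ℕ n) ∸ 2) (λ i → entryX m n σ ϑ (toℕ i) (toℕ (π ⟨$⟩ʳ i)))

-- The entry of row k in a marked column j is its block's constant (σ or ϑ) plus j minus the index
-- of k within its block. Summing over a permutation, the column indices give the triangular
-- number 0 + 1 + … + (N−1) with N = (n−1) + (m−1), while the in-block row indices give the
-- triangular numbers for n−1 and m−1, which fall short of it by exactly (m−1)(n−1). Hence every
-- selection sums to (n−1)σ + (m−1)ϑ + (m−1)(n−1) = (m−1+σ)(n−1+ϑ) − σϑ.
module Submission where

open import Defs
open import Level using (Level)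
open import Data.Nat as ℕ using (ℕ; zero; suc; _≤_; _<_; _∸_; _<ᵇ_; s≤s)
open import Data.Nat.Properties using (<⇒≤; <⇒<ᵇ; +-suc; +-comm; m∸n+n≡m; m+n∸m≡n)
open import Data.Fin using (Fin; toℕ)
open import Data.Fin.Properties using (toℕ<n)
open import Data.Fin.Permutation using (Permutation′; _⟨$⟩ʳ_)
open import Data.Bool using (true; false; if_then_else_)
open import Data.Bool.Properties using (T-≡)
open import Data.Maybe using (nothing)
open import Data.Product using (_,_)
open import Function.Bundles using (Equivalence)
open import Relation.Binary.PropositionalEquality as ≡ using (_≡_)
open import Algebra.Bundles using (CommutativeRing)
import Algebra.Properties.CommutativeMonoid.Sum as MonoidSum

<⇒<ᵇ≡true : ∀ {k b} → k < b → (k <ᵇ b) ≡ true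
<⇒<ᵇ≡true k<b = Equivalence.to T-≡ (<⇒<ᵇ k<b)

m+n<ᵇm≡false : ∀ m n → (m ℕ.+ n <ᵇ m) ≡ false
m+n<ᵇm≡false zero    n = ≡.refl
m+n<ᵇm≡false (suc m) n = m+n<ᵇm≡false m n

m+n∸2≡n∸1+m∸1 : ∀ {m n} → 1 ≤ m → 1 ≤ n → (m ℕ.+ n) ∸ 2 ≡ (n ∸ 1) ℕ.+ (m ∸ 1)
m+n∸2≡n∸1+m∸1 {suc m} {suc n} (s≤s _) (s≤s _) =
  ≡.trans (≡.cong (_∸ 1) (+-suc m n)) (+-comm m n)

-- entryX m n σ ϑ i j is definitionally stack (n ∸ 1) (λ k → entryA σ k j) (λ k → entryA ϑ k j) i.
stack : ∀ {a} {A : Set a} → ℕ → (ℕ → A) → (ℕ → A) → ℕ → A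
stack b f g k = if k <ᵇ b then f k else g (k ∸ b)

stack-< : ∀ {a} {A : Set a} {b k} (f g : ℕ → A) → k < b → stack b f g k ≡ f k
stack-< {b = b} {k} f g k<b = ≡.cong (λ t → if t then f k else g (k ∸ b)) (<⇒<ᵇ≡true k<b)

stack-+ : ∀ {a} {A : Set a} b k (f g : ℕ → A) → stack b f g (b ℕ.+ k) ≡ g k
stack-+ b k f g = ≡.trans
  (≡.cong (λ t → if t then f (b ℕ.+ k) else g (b ℕ.+ k ∸ b)) (m+n<ᵇm≡false b k))
  (≡.cong g (m+n∸m≡n b k))

module _ {c ℓ : Level} (R : CommutativeRing c ℓ) where
  open CommutativeRing R
  open import Relation.Binary.Reasoning.Setoid setoid
  module Σ = MonoidSum +-commutativeMonoid
  open import Algebra.Properties.Group +-group using (x≈z//y; ∙-cancelʳ)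
  open import Algebra.Properties.CommutativeSemigroup +-commutativeSemigroup using (xy∙z≈xz∙y)
  open import Algebra.Solver.Ring.NaturalCoefficients commutativeSemiring (λ _ _ → nothing)

  ι-homo-+ : ∀ m n → ι R (m ℕ.+ n) ≈ ι R m + ι R n
  ι-homo-+ zero    n = sym (+-identityˡ _)
  ι-homo-+ (suc m) n = trans (+-congˡ (ι-homo-+ m n)) (sym (+-assoc _ _ _))

  sumFin≡sum : ∀ N (f : Fin N → Carrier) → sumFin R N f ≡ Σ.sum f
  sumFin≡sum zero    f = ≡.refl
  sumFin≡sum (suc N) f = ≡.cong (f Fin.zero +_) (sumFin≡sum N (λ i → f (Fin.suc i)))

  sumFin-cong : ∀ N {f g : Fin N → Carrier} → (∀ i → f i ≈ g i) → sumFin R N f ≈ sumFin R N g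
  sumFin-cong zero    f≈g = refl
  sumFin-cong (suc N) f≈g = +-cong (f≈g Fin.zero) (sumFin-cong N (λ i → f≈g (Fin.suc i)))

  sumFin-distrib-+ : ∀ N (f g : Fin N → Carrier) →
    sumFin R N (λ i → f i + g i) ≈ sumFin R N f + sumFin R N g
  sumFin-distrib-+ N f g = begin
    sumFin R N (λ i → f i + g i)  ≡⟨ sumFin≡sum N _ ⟩
    Σ.sum (λ i → f i + g i)       ≈⟨ Σ.∑-distrib-+ f g ⟩
    Σ.sum f + Σ.sum g             ≡⟨ ≡.cong₂ _+_ (sumFin≡sum N f) (sumFin≡sum N g) ⟨
    sumFin R N f + sumFin R N g   ∎

  sumFin-permute : ∀ N (f : Fin N → Carrier) (π : Permutation′ N) →
    sumFin R N (λ i → f (π ⟨$⟩ʳ i)) ≈ sumFin R N f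
  sumFin-permute N f π = begin
    sumFin R N (λ i → f (π ⟨$⟩ʳ i))  ≡⟨ sumFin≡sum N _ ⟩
    Σ.sum (λ i → f (π ⟨$⟩ʳ i))       ≈⟨ Σ.sum-permute f π ⟨
    Σ.sum f                          ≡⟨ sumFin≡sum N f ⟨
    sumFin R N f                     ∎

  sumFin-const : ∀ N x → sumFin R N (λ _ → x) ≈ ι R N * x
  sumFin-const zero    x = sym (zeroˡ x)
  sumFin-const (suc N) x =
    trans (+-cong (sym (*-identityˡ x)) (sumFin-const N x)) (sym (distribʳ x 1# (ι R N)))

  sumFin-splitAt : ∀ p q (f : ℕ → Carrier) →
    sumFin R (p ℕ.+ q) (λ i → f (toℕ i))
      ≈ sumFin R p (λ i → f (toℕ i)) + sumFin R q (λ i → f (p ℕ.+ toℕ i))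
  sumFin-splitAt zero    q f = sym (+-identityˡ _)
  sumFin-splitAt (suc p) q f = trans (+-congˡ (sumFin-splitAt p q (λ k → f (suc k)))) (sym (+-assoc _ _ _))

  sumFin-stack : ∀ p q (f g : ℕ → Carrier) →
    sumFin R (p ℕ.+ q) (λ i → stack p f g (toℕ i))
      ≈ sumFin R p (λ i → f (toℕ i)) + sumFin R q (λ i → g (toℕ i))
  sumFin-stack p q f g = trans (sumFin-splitAt p q (stack p f g)) (+-cong
    (sumFin-cong p (λ i → reflexive (stack-< f g (toℕ<n i))))
    (sumFin-cong q (λ i → reflexive (stack-+ p (toℕ i) f g))))

  triangle : ℕ → Carrier
  triangle N = sumFin R N (λ i → ι R (toℕ i))

  triangle-+ : ∀ p q → triangle (p ℕ.+ q) ≈ triangle p + (ι R q * ι R p + triangle q)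
  triangle-+ p q = begin
    triangle (p ℕ.+ q)                                    ≈⟨ sumFin-splitAt p q (ι R) ⟩
    triangle p + sumFin R q (λ i → ι R (p ℕ.+ toℕ i))     ≈⟨ +-congˡ (sumFin-cong q (λ i → ι-homo-+ p (toℕ i))) ⟩
    triangle p + sumFin R q (λ i → ι R p + ι R (toℕ i))   ≈⟨ +-congˡ (sumFin-distrib-+ q _ _) ⟩
    triangle p + (sumFin R q (λ _ → ι R p) + triangle q)  ≈⟨ +-congˡ (+-congʳ (sumFin-const q (ι R p))) ⟩
    triangle p + (ι R q * ι R p + triangle q)             ∎

  -- Stated with the row index added on the left, so that no subtraction in R is needed.
  sumFin-staircase : ∀ N (π : Permutation′ N) (e r s : Fin N → Carrier) →
    (∀ i → e i + r i ≈ s i + ι R (toℕ (π ⟨$⟩ʳ i))) →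
    sumFin R N e + sumFin R N r ≈ sumFin R N s + triangle N
  sumFin-staircase N π e r s e+r≈s+π = begin
    sumFin R N e + sumFin R N r                              ≈⟨ sumFin-distrib-+ N e r ⟨
    sumFin R N (λ i → e i + r i)                             ≈⟨ sumFin-cong N e+r≈s+π ⟩
    sumFin R N (λ i → s i + ι R (toℕ (π ⟨$⟩ʳ i)))           ≈⟨ sumFin-distrib-+ N _ _ ⟩
    sumFin R N s + sumFin R N (λ i → ι R (toℕ (π ⟨$⟩ʳ i)))  ≈⟨ +-congˡ (sumFin-permute N (λ i → ι R (toℕ i)) π) ⟩
    sumFin R N s + triangle N                                ∎

  entryA+row : ∀ m σ i j → markedA R m i j → entryA R σ i j + ι R i ≈ σ + ι R j
  entryA+row m σ i j (i≤j , _) =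
    trans (+-assoc _ _ _) (+-congˡ (trans (sym (ι-homo-+ (j ∸ i) i)) (reflexive (≡.cong (ι R) (m∸n+n≡m i≤j)))))

  entryX+row : ∀ m n σ ϑ i j → markedX R m n i j →
    entryX R m n σ ϑ i j + stack (n ∸ 1) (ι R) (ι R) i ≈ stack (n ∸ 1) (λ _ → σ) (λ _ → ϑ) i + ι R j
  entryX+row m n σ ϑ i j marked with i <ᵇ (n ∸ 1)
  ... | true  = entryA+row m σ i j marked
  ... | false = entryA+row n ϑ (i ∸ (n ∸ 1)) j marked

  bigΣ-from-triangles : ∀ S a b σ ϑ Tb Ta →
    S + (Tb + Ta) ≈ (b * σ + a * ϑ) + (Tb + (a * b + Ta)) → S ≈ (a + σ) * (b + ϑ) - σ * ϑ
  bigΣ-from-triangles S a b σ ϑ Tb Ta eq = x≈z//y S (σ * ϑ) _ (∙-cancelʳ (Tb + Ta) _ _ (begin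
    (S + σ * ϑ) + (Tb + Ta)                         ≈⟨ xy∙z≈xz∙y S (σ * ϑ) (Tb + Ta) ⟩
    (S + (Tb + Ta)) + σ * ϑ                         ≈⟨ +-congʳ eq ⟩
    ((b * σ + a * ϑ) + (Tb + (a * b + Ta))) + σ * ϑ ≈⟨ expand a b σ ϑ Tb Ta ⟩
    (a + σ) * (b + ϑ) + (Tb + Ta)                   ∎))
    where
    expand : ∀ a b σ ϑ Tb Ta →
      ((b * σ + a * ϑ) + (Tb + (a * b + Ta))) + σ * ϑ ≈ (a + σ) * (b + ϑ) + (Tb + Ta)
    expand = solve 6 (λ a b σ ϑ Tb Ta →
      ((b :* σ :+ a :* ϑ) :+ (Tb :+ (a :* b :+ Ta))) :+ σ :* ϑ := (a :+ σ) :* (b :+ ϑ) :+ (Tb :+ Ta)) refl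

  selectionSum+triangles : ∀ m n σ ϑ (π : Permutation′ ((m ℕ.+ n) ∸ 2)) → 1 ≤ m → 1 ≤ n →
    (∀ i → markedX R m n (toℕ i) (toℕ (π ⟨$⟩ʳ i))) →
    selectionSum R m n σ ϑ π + (triangle (n ∸ 1) + triangle (m ∸ 1))
      ≈ (ι R (n ∸ 1) * σ + ι R (m ∸ 1) * ϑ)
        + (triangle (n ∸ 1) + (ι R (m ∸ 1) * ι R (n ∸ 1) + triangle (m ∸ 1)))
  selectionSum+triangles m n σ ϑ π 1≤m 1≤n marked = begin
    selectionSum R m n σ ϑ π + (triangle b + triangle a)       ≈⟨ +-congˡ rows ⟨
    selectionSum R m n σ ϑ π + sumFin R N (λ i → row (toℕ i))  ≈⟨ sumFin-staircase N π _ _ _ entry+row ⟩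
    sumFin R N (λ i → shift (toℕ i)) + triangle N              ≈⟨ +-cong shifts columns ⟩
    (ι R b * σ + ι R a * ϑ) + (triangle b + (ι R a * ι R b + triangle a)) ∎
    where
    N = (m ℕ.+ n) ∸ 2
    a = m ∸ 1
    b = n ∸ 1
    N≡b+a : N ≡ b ℕ.+ a
    N≡b+a = m+n∸2≡n∸1+m∸1 1≤m 1≤n
    row : ℕ → Carrier
    row = stack b (ι R) (ι R)
    shift : ℕ → Carrier
    shift = stack b (λ _ → σ) (λ _ → ϑ)
    entry+row : ∀ i →
      entryX R m n σ ϑ (toℕ i) (toℕ (π ⟨$⟩ʳ i)) + row (toℕ i) ≈ shift (toℕ i) + ι R (toℕ (π ⟨$⟩ʳ i))
    entry+row i = entryX+row m n σ ϑ (toℕ i) _ (marked i)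
    rows : sumFin R N (λ i → row (toℕ i)) ≈ triangle b + triangle a
    rows = trans (reflexive (≡.cong (λ N → sumFin R N (λ i → row (toℕ i))) N≡b+a))
                 (sumFin-stack b a (ι R) (ι R))
    shifts : sumFin R N (λ i → shift (toℕ i)) ≈ ι R b * σ + ι R a * ϑ
    shifts = begin
      sumFin R N (λ i → shift (toℕ i))              ≡⟨ ≡.cong (λ N → sumFin R N (λ i → shift (toℕ i))) N≡b+a ⟩
      sumFin R (b ℕ.+ a) (λ i → shift (toℕ i))      ≈⟨ sumFin-stack b a (λ _ → σ) (λ _ → ϑ) ⟩
      sumFin R b (λ _ → σ) + sumFin R a (λ _ → ϑ)  ≈⟨ +-cong (sumFin-const b σ) (sumFin-const a ϑ) ⟩
      ι R b * σ + ι R a * ϑ                         ∎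
    columns : triangle N ≈ triangle b + (ι R a * ι R b + triangle a)
    columns = trans (reflexive (≡.cong triangle N≡b+a)) (triangle-+ b a)

open import Data.Nat using (_+_)

lemma2p1 : {c ℓ : Level} (R : CommutativeRing c ℓ) (m n : ℕ) → 2 ≤ m → 2 ≤ n →
    (σ ϑ : CommutativeRing.Carrier R) →
    (π : Permutation′ ((m + n) ∸ 2)) →
    (∀ i → markedX R m n (toℕ i) (toℕ (π ⟨$⟩ʳ i))) →
    CommutativeRing._≈_ R (selectionSum R m n σ ϑ π) (bigΣ R m n σ ϑ)
lemma2p1 R m n 2≤m 2≤n σ ϑ π marked =
  bigΣ-from-triangles R _ (ι R (m ∸ 1)) (ι R (n ∸ 1)) σ ϑ _ _
    (selectionSum+triangles R m n σ ϑ π (<⇒≤ 2≤m) (<⇒≤ 2≤n) marked)
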